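{- Let $\mathbf S$ be a species and, for each $i\ge 0$, let $a_i$ be the number of $\mathbf S$-structures on an $i$-element set. Let $q_n(\mathbf y)=p_n(\mathbf y)/n!$ be the linear sequence of divided powers associated with $\mathbf S$. Then for every $n\ge 0$, $$q_n(\mathbf y)=\sum_{\lambda\vdash n}\Big(\prod_{i=1}^{\ell(\lambda)}\frac{a_{\lambda_i}}{\lambda_i!}\Big)\,m_\lambda(\mathbf y),$$ the sum being over all partitions $\lambda$ of $n$.
   Context: Symmetric functions are in the countably many variables $\mathbf y=(y_1,y_2,\dots)$ over $\mathbb C$. A partition $\lambda$ is a nonincreasing sequence of nonnegative integers that is eventually $0$; $\ell(\lambda)$ is its number of nonzero parts, $\lambda\vdash n$ means its parts sum to $n$, and $m_\lambda(\mathbf y)=\sum_\alpha y_1^{\alpha_1}y_2^{\alpha_2}\cdots$ summed over all distinct rearrangements $\alpha$ of $\lambda$ (monomial symmetric function). A species $\mathbf S$ is a functor from the category of finite sets and bijections to itself, with $|\mathbf S[\emptyset]|=1$ and $|\mathbf S[E]|\ge 1$ when $|E|=1$. An $\mathbf S$-enriched function from a finite set $N$ to a set $X$ is a pair $(f,(A_x)_{x\in X})$ with $f:N\to X$ and $A_x\in\mathbf S[f^{ -1}(x)]$ for each $x$. The linear sequence of binomial type associated with $\mathbf S$ is $p_n(\mathbf y)=\sum \prod_{i=1}^n y_{f(i)}$, the sum over all $\mathbf S$-enriched functions $(f,(A_k))$ from $\{1,\dots,n\}$ to $\{1,2,3,\dots\}$; its divided powers are $q_n=p_n/n!$. -}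

module Defs where

open import Data.Nat using (ℕ; zero; suc; _≤_; _<_; _≥_; _≤?_; _!)
import Data.Nat as ℕ
open import Data.Nat.Properties using (_!≢0)
open import Data.Fin using (Fin; _≟_)
open import Data.Vec using (Vec; []; _∷_; tabulate; toList)
import Data.Vec.Properties as VecP
open import Data.List using (List; []; _∷_; _++_; [_]; map; concatMap; filter; foldr)
open import Data.Nat.ListAction using (product; sum)
open import Data.List.Relation.Unary.All using (All)
open import Data.List.Relation.Unary.Linked using (Linked)
open import Data.List.Relation.Unary.Unique.Propositional using (Unique)
open import Data.List.Membership.Propositional using (_∈_)
open import Data.List.Relation.Unary.Any using (here)
open import Data.List.Relation.Binary.Permutation.Propositional using (_↭_; prep; ↭-sym; ↭-trans)
open import Data.List.Relation.Binary.Permutation.Propositional.Properties using (¬x∷xs↭[]; ∈-resp-↭; shift; drop-mid)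
open import Data.List.Membership.Propositional.Properties using (∈-∃++)
import Data.List.Membership.DecPropositional as DecMem
open import Data.Integer using (+_)
open import Data.Rational using (ℚ; _/_; _*_; _+_; 0ℚ; 1ℚ)
open import Data.Product using (_×_; _,_)
open import Data.Bool using (if_then_else_)
open import Function.Bundles using (_↔_; _⇔_; Inverse)
open import Function.Construct.Identity using (↔-id)
open import Function.Construct.Composition using (_↔-∘_)
open import Relation.Nullary using (Dec; yes; no; does)
open import Relation.Binary.PropositionalEquality using (_≡_; refl; subst)

-- Str k  : the set S[{1..k}] of S-structures on a standard k-element set;
--          S[E] for any finite E with |E| = k is identified with Str k
--          through an ordering of E (functoriality: the count is the same).
-- card k : a_k, the number of S-structures on a k-element set.
-- relabel: the action of S on bijections of the standard k-set, with
--          functor laws (stated pointwise).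

record Species : Set₁ where
  field
    Str            : ℕ → Set
    card           : ℕ → ℕ
    enumerate      : (k : ℕ) → Str k ↔ Fin (card k)
    relabel        : {k : ℕ} → Fin k ↔ Fin k → Str k → Str k
    relabel-id     : {k : ℕ} (s : Str k) → relabel (↔-id (Fin k)) s ≡ s
    relabel-∘      : {k : ℕ} (σ τ : Fin k ↔ Fin k) (s : Str k) →
                     relabel (σ ↔-∘ τ) s ≡ relabel σ (relabel τ s)
    card-empty     : card 0 ≡ 1
    card-singleton : 1 ≤ card 1

-- A monomial y^α in the variables y_1, y_2, ... is given by
-- an exponent vector α : Vec ℕ m (exponent of y_{i+1} is the i-th entry,
-- all exponents beyond position m are 0).  Every monomial arises this way
-- (for m large enough), so a formal power series is determined by the
-- function  (m : ℕ) → Vec ℕ m → coefficient.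

allFuns : (n m : ℕ) → List (Vec (Fin m) n)
allFuns zero    m = [ [] ]
allFuns (suc n) m = concatMap (λ i → map (i ∷_) (allFuns n m)) (Data.List.allFin m)
  where import Data.List

fiberSize : {n m : ℕ} → Vec (Fin m) n → Fin m → ℕ
fiberSize f x = Data.Vec.count (_≟ x) f
  where import Data.Vec

-- (|f⁻¹(x)|)_x : the exponent vector of the monomial  ∏_i y_{f(i)}
fiberVec : {n m : ℕ} → Vec (Fin m) n → Vec ℕ m
fiberVec f = tabulate (fiberSize f)

-- number of families (A_x)_x with A_x ∈ S[f⁻¹(x)], x ∈ {1..m}
-- (fibres over x > m are empty and carry |S[∅]| = 1 structure)
enrichments : Species → {n m : ℕ} → Vec (Fin m) n → ℕ
enrichments S f = product (toList (Data.Vec.map (Species.card S) (fiberVec f)))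
  where import Data.Vec

-- Coefficient of y^α in p_n(y) = Σ_{(f,(A_x)) S-enriched} ∏_i y_{f(i)}:
-- the number of S-enriched functions (f,(A_x)) with  ∏_i y_{f(i)} = y^α.
-- Such f necessarily take values in {1..m}.
pCoeff : Species → (n : ℕ) → {m : ℕ} → Vec ℕ m → ℕ
pCoeff S n {m} α =
  sum (map (λ f → if does (VecP.≡-dec Data.Nat._≟_ (fiberVec f) α)
                  then enrichments S f else 0)
           (allFuns n m))
  where import Data.Nat

qCoeff : Species → (n : ℕ) → {m : ℕ} → Vec ℕ m → ℚ
qCoeff S n α = (+ pCoeff S n α) / (n !)
  where instance _ = n !≢0

record IsPartition (n : ℕ) (ps : List ℕ) : Set where
  field
    nonincreasing : Linked _≥_ ps
    positive      : All (λ p → 1 ≤ p) ps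
    total         : sum ps ≡ n

PartitionsOf : ℕ → List (List ℕ) → Set
PartitionsOf n Ps = Unique Ps × ((ps : List ℕ) → (ps ∈ Ps) ⇔ IsPartition n ps)

infix 4 _↭?_
_↭?_ : (xs ys : List ℕ) → Dec (xs ↭ ys)
[] ↭? [] = yes _↭_.refl
[] ↭? (y ∷ ys) = no (λ p → ¬x∷xs↭[] (↭-sym p))
(x ∷ xs) ↭? ys with DecMem._∈?_ Data.Nat._≟_ x ys
  where import Data.Nat
... | no x∉ = no (λ p → x∉ (∈-resp-↭ p (here refl)))
... | yes x∈ with ∈-∃++ x∈
...   | ys₁ , ys₂ , refl with xs ↭? (ys₁ ++ ys₂)
...     | yes p = yes (↭-trans (prep x p) (↭-sym (shift x ys₁ ys₂)))
...     | no ¬p = no (λ q → ¬p (drop-mid [] ys₁ q))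

-- Coefficient of y^α in the monomial symmetric function m_λ:
-- 1 if α (padded with zeros) is a rearrangement of λ (padded with zeros),
-- i.e. the nonzero exponents of α are a permutation of the parts of λ;
-- 0 otherwise.
mCoeff : List ℕ → {m : ℕ} → Vec ℕ m → ℚ
mCoeff ps α = if does (filter (1 ≤?_) (toList α) ↭? ps) then 1ℚ else 0ℚ

partWeight : Species → List ℕ → ℚ
partWeight S ps = foldr (λ p acc → factor p * acc) 1ℚ ps
  where
  factor : ℕ → ℚ
  factor p = (+ Species.card S p) / (p !)
    where instance _ = p !≢0

rhsCoeff : Species → List (List ℕ) → {m : ℕ} → Vec ℕ m → ℚ
rhsCoeff S Ps α = foldr (λ ps acc → partWeight S ps * mCoeff ps α + acc) 0ℚ Ps

{-# OPTIONS --safe #-}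
module Submission where

-- The coefficient of y^α in p_n counts the S-enriched functions with fibre sizes α: the words of
-- length n with content α, of which there are n! / ∏ α_i! (the multinomial coefficient) when
-- |α| = n and none otherwise, each carrying ∏ a_{α_i} enrichments. The multinomial count
-- follows by induction on n: removing the first letter i lowers α_i by one. Hence y^α has coefficient
-- ∏ a_{α_i} / α_i! in q_n. On the right, y^α occurs in exactly one m_λ, namely for λ the
-- nonzero entries of α sorted, and with coefficient 1; the weight of that λ is the same
-- product because a_0 = 0! = 1.

open import Defs
open import Data.Bool using (if_then_else_)
open import Data.Fin using (Fin; zero; suc)
import Data.Fin as Fin
open import Data.Integer using (+_)
import Data.Integer.Properties as ℤP
open import Data.List using (List; []; _∷_; _++_; map; filter; foldr; concatMap; allFin)
import Data.List as List
import Data.List.Properties as ListP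
open import Data.List.Membership.Propositional using (_∈_)
open import Data.List.Relation.Binary.Permutation.Propositional using (_↭_; ↭-sym; ↭-trans; ↭⇒↭ₛ′)
open import Data.List.Relation.Binary.Permutation.Propositional.Properties using (All-resp-↭; map⁺)
import Data.List.Relation.Binary.Pointwise as Pointwise
import Data.List.Relation.Unary.All as All
open import Data.List.Relation.Unary.All.Properties using (all-filter)
open import Data.List.Relation.Unary.AllPairs using (_∷_)
open import Data.List.Relation.Unary.Any using (here; there)
open import Data.List.Relation.Unary.Linked using (Linked)
open import Data.List.Relation.Unary.Unique.Propositional using (Unique)
import Data.List.Relation.Unary.Sorted.TotalOrder.Properties as SortedP
import Data.List.Sort as Sort
open import Data.Nat using (ℕ; zero; suc; pred; _+_; _*_; _!; _≤?_; _≥_; NonZero)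
import Data.Nat.Properties as ℕP
open import Algebra.Properties.CommutativeSemigroup ℕP.*-commutativeSemigroup using (x∙yz≈y∙xz; xy∙z≈y∙xz)
open import Data.Nat.ListAction using (sum; product)
open import Data.Nat.ListAction.Properties using (sum-++; sum-↭; product-↭)
open import Data.Product using (proj₁; proj₂)
open import Data.Rational using (ℚ; _/_; 0ℚ; 1ℚ; toℚᵘ) renaming (_*_ to _*ℚ_; _+_ to _+ℚ_)
import Data.Rational.Properties as ℚP
import Data.Rational.Unnormalised as ℚᵘ
import Data.Rational.Unnormalised.Properties as ℚᵘP
open import Data.Vec using (Vec; []; _∷_; lookup; toList; _[_]%=_)
import Data.Vec as Vec
import Data.Vec.Properties as VecP
open import Function using (_∘_)
open import Function.Bundles using (Equivalence; mk⇔)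
open import Relation.Binary.Bundles using (DecTotalOrder)
import Relation.Binary.Construct.Flip.Ord as Flip
open import Relation.Binary.PropositionalEquality
open import Relation.Nullary using (Dec; yes; no; ¬_; does)
open import Relation.Nullary.Decidable using (dec-true; dec-false; does-⇔)
open import Relation.Unary using (Decidable)

open Species using (card)

∏ : (ℕ → ℕ) → List ℕ → ℕ
∏ h xs = product (map h xs)

∏!≢0 : ∀ xs → NonZero (∏ _! xs)
∏!≢0 []       = _
∏!≢0 (x ∷ xs) = ℕP.m*n≢0 (x !) (∏ _! xs) {{x ℕP.!≢0}} {{∏!≢0 xs}}

_/∏!_ : ℕ → List ℕ → ℚ
k /∏! xs = (+ k / ∏ _! xs) {{∏!≢0 xs}}

cross-*⇒/≡/ : ∀ a b c d .{{_ : NonZero b}} .{{_ : NonZero d}} → a * d ≡ c * b → + a / b ≡ + c / d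
cross-*⇒/≡/ a (suc b) c (suc d) ad≡cb =
  ℚP.fromℚᵘ-cong {ℚᵘ.mkℚᵘ (+ a) b} {ℚᵘ.mkℚᵘ (+ c) d} (ℚᵘ.*≡* (trans (sym (ℤP.pos-* a (suc d))) (trans (cong +_ ad≡cb) (ℤP.pos-* c (suc b)))))

/-*-/ : ∀ a b c d .{{_ : NonZero b}} .{{_ : NonZero d}} →
        (+ a / b) *ℚ (+ c / d) ≡ (+ (a * c) / (b * d)) {{ℕP.m*n≢0 b d}}
/-*-/ a (suc b) c (suc d) = ℚP.toℚᵘ-injective (begin
  toℚᵘ ((+ a / suc b) *ℚ (+ c / suc d))              ≈⟨ ℚP.toℚᵘ-homo-* (+ a / suc b) (+ c / suc d) ⟩
  toℚᵘ (+ a / suc b) ℚᵘ.* toℚᵘ (+ c / suc d)         ≈⟨ ℚᵘP.*-cong (ℚP.toℚᵘ-fromℚᵘ (ℚᵘ.mkℚᵘ (+ a) b)) (ℚP.toℚᵘ-fromℚᵘ (ℚᵘ.mkℚᵘ (+ c) d)) ⟩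
  ℚᵘ.mkℚᵘ (+ a) b ℚᵘ.* ℚᵘ.mkℚᵘ (+ c) d               ≡⟨ cong (λ z → ℚᵘ.mkℚᵘ z (pred (suc b * suc d))) (ℤP.pos-* a c) ⟨
  ℚᵘ.mkℚᵘ (+ (a * c)) (pred (suc b * suc d))          ≈⟨ ℚP.toℚᵘ-fromℚᵘ _ ⟨
  toℚᵘ (+ (a * c) / (suc b * suc d))                 ∎)
  where open ℚᵘP.≃-Reasoning

sum-map-*ʳ : ∀ {A : Set} (f : A → ℕ) c xs → sum (map (λ x → f x * c) xs) ≡ sum (map f xs) * c
sum-map-*ʳ f c []       = refl
sum-map-*ʳ f c (x ∷ xs) = trans (cong (_+_ (f x * c)) (sum-map-*ʳ f c xs)) (sym (ℕP.*-distribʳ-+ c (f x) _))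

sum-map-0 : ∀ {A : Set} {f : A → ℕ} → (∀ x → f x ≡ 0) → ∀ xs → sum (map f xs) ≡ 0
sum-map-0 f≡0 []       = refl
sum-map-0 f≡0 (x ∷ xs) = cong₂ _+_ (f≡0 x) (sum-map-0 f≡0 xs)

sum-map-concatMap : ∀ {A B : Set} (f : B → ℕ) (g : A → List B) xs →
                    sum (map f (concatMap g xs)) ≡ sum (map (λ x → sum (map f (g x))) xs)
sum-map-concatMap f g []       = refl
sum-map-concatMap f g (x ∷ xs) = begin
  sum (map f (g x ++ concatMap g xs))                         ≡⟨ cong sum (ListP.map-++ f (g x) _) ⟩
  sum (map f (g x) ++ map f (concatMap g xs))                 ≡⟨ sum-++ (map f (g x)) _ ⟩
  sum (map f (g x)) + sum (map f (concatMap g xs))            ≡⟨ cong (_+_ (sum (map f (g x)))) (sum-map-concatMap f g xs) ⟩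
  sum (map f (g x)) + sum (map (λ y → sum (map f (g y))) xs)  ∎
  where open ≡-Reasoning

degree : ∀ {m} → Vec ℕ m → ℕ
degree α = sum (toList α)

sum-allFin-lookup : ∀ {m} (α : Vec ℕ m) → sum (map (lookup α) (allFin m)) ≡ degree α
sum-allFin-lookup {m} α = cong sum (trans (ListP.map-tabulate (λ i → i) (lookup α)) (tabulate-lookup α))
  where
  tabulate-lookup : ∀ {m} (α : Vec ℕ m) → List.tabulate (lookup α) ≡ toList α
  tabulate-lookup []      = refl
  tabulate-lookup (x ∷ α) = cong (x ∷_) (tabulate-lookup α)

degree-[]%=suc : ∀ {m} (v : Vec ℕ m) i → degree (v [ i ]%= suc) ≡ suc (degree v)
degree-[]%=suc (x ∷ v) zero    = refl
degree-[]%=suc (x ∷ v) (suc i) = trans (cong (_+_ x) (degree-[]%=suc v i)) (ℕP.+-suc x _)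

[]%=pred-[]%=suc : ∀ {m} (α : Vec ℕ m) i {k} → lookup α i ≡ suc k → α [ i ]%= pred [ i ]%= suc ≡ α
[]%=pred-[]%=suc α i αᵢ≡ = trans (VecP.[]%=-∘ α i) (VecP.updateAt-id-local i α (trans (cong (λ (x : ℕ) → suc (pred x)) αᵢ≡) (sym αᵢ≡)))

degree-[]%=pred : ∀ {m} (α : Vec ℕ m) i {k n} → lookup α i ≡ suc k → degree α ≡ suc n → degree (α [ i ]%= pred) ≡ n
degree-[]%=pred α i αᵢ≡ deg≡ = ℕP.suc-injective (begin
  suc (degree (α [ i ]%= pred))        ≡⟨ degree-[]%=suc (α [ i ]%= pred) i ⟨
  degree (α [ i ]%= pred [ i ]%= suc)  ≡⟨ cong degree ([]%=pred-[]%=suc α i αᵢ≡) ⟩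
  degree α                             ≡⟨ deg≡ ⟩
  suc _                                ∎)
  where open ≡-Reasoning

∏!-[]%=pred : ∀ {m} (α : Vec ℕ m) i {k} → lookup α i ≡ suc k →
              ∏ _! (toList α) ≡ suc k * ∏ _! (toList (α [ i ]%= pred))
∏!-[]%=pred (x ∷ α) zero    {k} refl = ℕP.*-assoc (suc k) (k !) _
∏!-[]%=pred (x ∷ α) (suc i) {k} αᵢ≡  =
  trans (cong (_*_ (x !)) (∏!-[]%=pred α i αᵢ≡)) (x∙yz≈y∙xz (x !) (suc k) _)

infix 4 _≟ᵛ_
_≟ᵛ_ : ∀ {m} (u v : Vec ℕ m) → Dec (u ≡ v)
_≟ᵛ_ = VecP.≡-dec ℕP._≟_

fiberVec-∷ : ∀ {n m} (i : Fin m) (f : Vec (Fin m) n) → fiberVec (i ∷ f) ≡ fiberVec f [ i ]%= suc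
fiberVec-∷ i f = trans (VecP.tabulate-cong fiberSize-∷) (VecP.tabulate∘lookup (fiberVec f [ i ]%= suc))
  where
  fiberSize-∷ : ∀ x → fiberSize (i ∷ f) x ≡ lookup (fiberVec f [ i ]%= suc) x
  fiberSize-∷ x with i Fin.≟ x
  ... | yes refl = sym (trans (VecP.lookup∘updateAt x (fiberVec f)) (cong suc (VecP.lookup∘tabulate _ x)))
  ... | no i≢x   = sym (trans (VecP.lookup∘updateAt′ x i (i≢x ∘ sym) (fiberVec f)) (VecP.lookup∘tabulate _ x))

degree-fiberVec : ∀ {n m} (f : Vec (Fin m) n) → degree (fiberVec f) ≡ n
degree-fiberVec {m = m} [] = degree-fiberVec[] m
  where
  degree-fiberVec[] : ∀ m → degree (fiberVec {m = m} []) ≡ 0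
  degree-fiberVec[] zero    = refl
  degree-fiberVec[] (suc m) = degree-fiberVec[] m
degree-fiberVec {suc n} (i ∷ f) = begin
  degree (fiberVec (i ∷ f))          ≡⟨ cong degree (fiberVec-∷ i f) ⟩
  degree (fiberVec f [ i ]%= suc)    ≡⟨ degree-[]%=suc (fiberVec f) i ⟩
  suc (degree (fiberVec f))          ≡⟨ cong suc (degree-fiberVec f) ⟩
  suc n                              ∎
  where open ≡-Reasoning

degree≡0⇒fiberVec[] : ∀ {m} (α : Vec ℕ m) → degree α ≡ 0 → fiberVec [] ≡ α
degree≡0⇒fiberVec[] []      _      = refl
degree≡0⇒fiberVec[] (x ∷ α) deg≡0 =
  cong₂ _∷_ (sym (ℕP.m+n≡0⇒m≡0 x deg≡0)) (degree≡0⇒fiberVec[] α (ℕP.m+n≡0⇒n≡0 x deg≡0))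

∏!-fiberVec[] : ∀ m → ∏ _! (toList (fiberVec {m = m} [])) ≡ 1
∏!-fiberVec[] zero    = refl
∏!-fiberVec[] (suc m) = trans (ℕP.+-identityʳ _) (∏!-fiberVec[] m)

fiberIndicator : ∀ {n m} → Vec ℕ m → Vec (Fin m) n → ℕ
fiberIndicator α f = if does (fiberVec f ≟ᵛ α) then 1 else 0

wordCount : (n : ℕ) {m : ℕ} → Vec ℕ m → ℕ
wordCount n {m} α = sum (map (fiberIndicator α) (allFuns n m))

pCoeff≡wordCount*∏card : ∀ S n {m} (α : Vec ℕ m) → pCoeff S n α ≡ wordCount n α * ∏ (card S) (toList α)
pCoeff≡wordCount*∏card S n {m} α =
  trans (cong sum (ListP.map-cong enrichedCount (allFuns n m))) (sum-map-*ʳ (fiberIndicator α) _ (allFuns n m))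
  where
  enrichedCount : ∀ f → (if does (fiberVec f ≟ᵛ α) then enrichments S f else 0) ≡ fiberIndicator α f * ∏ (card S) (toList α)
  enrichedCount f with fiberVec f ≟ᵛ α
  ... | yes fiberVec≡α = begin
    product (toList (Vec.map (card S) (fiberVec f))) ≡⟨ cong product (VecP.toList-map (card S) (fiberVec f)) ⟩
    ∏ (card S) (toList (fiberVec f))                     ≡⟨ cong (∏ (card S) ∘ toList) fiberVec≡α ⟩
    ∏ (card S) (toList α)                                ≡⟨ ℕP.*-identityˡ _ ⟨
    1 * ∏ (card S) (toList α)                            ∎
    where open ≡-Reasoning
  ... | no _ = refl

wordCount-degree≢ : ∀ n {m} (α : Vec ℕ m) → degree α ≢ n → wordCount n α ≡ 0
wordCount-degree≢ n {m} α deg≢n = sum-map-0 noWord (allFuns n m)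
  where
  noWord : ∀ f → fiberIndicator α f ≡ 0
  noWord f = cong (λ b → if b then 1 else 0)
    (dec-false (fiberVec f ≟ᵛ α) (λ fiberVec≡α → deg≢n (trans (cong degree (sym fiberVec≡α)) (degree-fiberVec f))))

wordCountFrom : ∀ {m} → Fin m → ℕ → Vec ℕ m → ℕ
wordCountFrom {m} i n α = sum (map (fiberIndicator α ∘ (i ∷_)) (allFuns n m))

wordCount-suc : ∀ n {m} (α : Vec ℕ m) → wordCount (suc n) α ≡ sum (map (λ i → wordCountFrom i n α) (allFin m))
wordCount-suc n {m} α = trans (sum-map-concatMap (fiberIndicator α) _ (allFin m))
  (cong sum (ListP.map-cong (λ i → cong sum (sym (ListP.map-∘ (allFuns n m)))) (allFin m)))

module _ {m} (α : Vec ℕ m) (i : Fin m) (n : ℕ) where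

  wordCountFrom-zero : lookup α i ≡ 0 → wordCountFrom i n α ≡ 0
  wordCountFrom-zero αᵢ≡0 = sum-map-0 noWord (allFuns n m)
    where
    noWord : ∀ f → fiberIndicator α (i ∷ f) ≡ 0
    noWord f = cong (λ b → if b then 1 else 0) (dec-false (fiberVec (i ∷ f) ≟ᵛ α) fiberVec≢α)
      where
      fiberVec≢α : fiberVec (i ∷ f) ≢ α
      fiberVec≢α fiberVec≡α = ℕP.0≢1+n (begin
        0                                  ≡⟨ αᵢ≡0 ⟨
        lookup α i                         ≡⟨ cong (λ v → lookup v i) (trans (sym fiberVec≡α) (fiberVec-∷ i f)) ⟩
        lookup (fiberVec f [ i ]%= suc) i  ≡⟨ VecP.lookup∘updateAt i (fiberVec f) ⟩
        suc (lookup (fiberVec f) i)        ∎)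
        where open ≡-Reasoning

  wordCountFrom-suc : ∀ {k} → lookup α i ≡ suc k → wordCountFrom i n α ≡ wordCount n (α [ i ]%= pred)
  wordCountFrom-suc αᵢ≡ = cong sum (ListP.map-cong tail (allFuns n m))
    where
    tail : ∀ f → fiberIndicator α (i ∷ f) ≡ fiberIndicator (α [ i ]%= pred) f
    tail f = cong (λ b → if b then 1 else 0) (does-⇔ (mk⇔ to from) (fiberVec (i ∷ f) ≟ᵛ α) (fiberVec f ≟ᵛ α [ i ]%= pred))
      where
      to : fiberVec (i ∷ f) ≡ α → fiberVec f ≡ α [ i ]%= pred
      to fiberVec≡α = begin
        fiberVec f                           ≡⟨ trans (VecP.[]%=-∘ (fiberVec f) i) (VecP.[]%=-id (fiberVec f) i) ⟨
        fiberVec f [ i ]%= suc [ i ]%= pred  ≡⟨ cong (_[ i ]%= pred) (trans (sym (fiberVec-∷ i f)) fiberVec≡α) ⟩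
        α [ i ]%= pred                       ∎
        where open ≡-Reasoning
      from : fiberVec f ≡ α [ i ]%= pred → fiberVec (i ∷ f) ≡ α
      from fiberVec≡ = trans (fiberVec-∷ i f) (trans (cong (_[ i ]%= suc) fiberVec≡) ([]%=pred-[]%=suc α i αᵢ≡))

wordCount-multinomial : ∀ n {m} (α : Vec ℕ m) → degree α ≡ n → wordCount n α * ∏ _! (toList α) ≡ n !
wordCount-multinomial zero {m} α deg≡0 with refl ← degree≡0⇒fiberVec[] α deg≡0 =
  cong₂ _*_ (cong (λ b → (if b then 1 else 0) + 0) (dec-true (fiberVec {m = m} [] ≟ᵛ fiberVec []) refl)) (∏!-fiberVec[] m)
wordCount-multinomial (suc n) {m} α deg≡ = begin
  wordCount (suc n) α * ∏ _! (toList α)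
    ≡⟨ cong (_* ∏ _! (toList α)) (wordCount-suc n α) ⟩
  sum (map (λ i → wordCountFrom i n α) (allFin m)) * ∏ _! (toList α)
    ≡⟨ sum-map-*ʳ (λ i → wordCountFrom i n α) _ (allFin m) ⟨
  sum (map (λ i → wordCountFrom i n α * ∏ _! (toList α)) (allFin m))
    ≡⟨ cong sum (ListP.map-cong firstLetter (allFin m)) ⟩
  sum (map (λ i → lookup α i * n !) (allFin m))
    ≡⟨ sum-map-*ʳ (lookup α) (n !) (allFin m) ⟩
  sum (map (lookup α) (allFin m)) * n !
    ≡⟨ cong (_* n !) (trans (sum-allFin-lookup α) deg≡) ⟩
  suc n * n ! ∎
  where
  open ≡-Reasoning
  firstLetter : ∀ i → wordCountFrom i n α * ∏ _! (toList α) ≡ lookup α i * n !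
  firstLetter i with lookup α i in αᵢ≡
  ... | zero  = cong (_* ∏ _! (toList α)) (wordCountFrom-zero α i n αᵢ≡)
  ... | suc k = begin
    wordCountFrom i n α * ∏ _! (toList α)        ≡⟨ cong₂ _*_ (wordCountFrom-suc α i n αᵢ≡) (∏!-[]%=pred α i αᵢ≡) ⟩
    wordCount n α′ * (suc k * ∏ _! (toList α′))  ≡⟨ x∙yz≈y∙xz (wordCount n α′) (suc k) _ ⟩
    suc k * (wordCount n α′ * ∏ _! (toList α′))  ≡⟨ cong (suc k *_) (wordCount-multinomial n α′ (degree-[]%=pred α i αᵢ≡ deg≡)) ⟩
    suc k * n !                                  ∎
    where α′ = α [ i ]%= pred

module _ (S : Species) {n m : ℕ} (α : Vec ℕ m) where

  qCoeff-degree≢ : degree α ≢ n → qCoeff S n α ≡ 0ℚ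
  qCoeff-degree≢ deg≢n = trans (ℚP./-cong {{n ℕP.!≢0}} {{n ℕP.!≢0}} (cong +_ pCoeff≡0) refl) (ℚP.0/n≡0 (n !) {{n ℕP.!≢0}})
    where
    pCoeff≡0 : pCoeff S n α ≡ 0
    pCoeff≡0 = trans (pCoeff≡wordCount*∏card S n α) (cong (_* ∏ (card S) (toList α)) (wordCount-degree≢ n α deg≢n))

  qCoeff-degree≡ : degree α ≡ n → qCoeff S n α ≡ ∏ (card S) (toList α) /∏! toList α
  qCoeff-degree≡ deg≡n =
    cross-*⇒/≡/ (pCoeff S n α) (n !) (∏ (card S) (toList α)) (∏ _! (toList α)) {{n ℕP.!≢0}} {{∏!≢0 (toList α)}} (begin
      pCoeff S n α * ∏ _! (toList α)
        ≡⟨ cong (_* ∏ _! (toList α)) (pCoeff≡wordCount*∏card S n α) ⟩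
      wordCount n α * ∏ (card S) (toList α) * ∏ _! (toList α)
        ≡⟨ xy∙z≈y∙xz (wordCount n α) _ _ ⟩
      ∏ (card S) (toList α) * (wordCount n α * ∏ _! (toList α))
        ≡⟨ cong (_*_ (∏ (card S) (toList α))) (wordCount-multinomial n α deg≡n) ⟩
      ∏ (card S) (toList α) * n ! ∎)
    where open ≡-Reasoning

module _ {A : Set} {P : A → Set} (P? : Decidable P) (w : A → ℚ) where

  sumWhere : List A → ℚ
  sumWhere = foldr (λ x acc → w x *ℚ (if does (P? x) then 1ℚ else 0ℚ) +ℚ acc) 0ℚ

  sumWhere-none : ∀ xs → (∀ {x} → x ∈ xs → ¬ P x) → sumWhere xs ≡ 0ℚ
  sumWhere-none []       _   = refl
  sumWhere-none (x ∷ xs) ¬P rewrite dec-false (P? x) (¬P (here refl)) =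
    trans (cong₂ _+ℚ_ (ℚP.*-zeroʳ (w x)) (sumWhere-none xs (¬P ∘ there))) (ℚP.+-identityʳ 0ℚ)

  sumWhere-unique : ∀ {xs x} → Unique xs → x ∈ xs → P x → (∀ {y} → y ∈ xs → P y → y ≡ x) → sumWhere xs ≡ w x
  sumWhere-unique {x ∷ xs} (x∉xs ∷ _) (here refl) Px onlyX rewrite dec-true (P? x) Px =
    trans (cong₂ _+ℚ_ (ℚP.*-identityʳ (w x)) (sumWhere-none xs λ y∈xs Py → All.lookup x∉xs y∈xs (sym (onlyX (there y∈xs) Py))))
          (ℚP.+-identityʳ (w x))
  sumWhere-unique {y ∷ xs} {x} (y∉xs ∷ xs-unique) (there x∈xs) Px onlyX
    rewrite dec-false (P? y) (λ Py → All.lookup y∉xs x∈xs (onlyX (here refl) Py)) =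
    trans (cong₂ _+ℚ_ (ℚP.*-zeroʳ (w y)) (sumWhere-unique xs-unique x∈xs Px (onlyX ∘ there))) (ℚP.+-identityˡ (w x))

nonzeroParts : List ℕ → List ℕ
nonzeroParts = filter (1 ≤?_)

sum-nonzeroParts : ∀ xs → sum (nonzeroParts xs) ≡ sum xs
sum-nonzeroParts []           = refl
sum-nonzeroParts (zero ∷ xs)  = sum-nonzeroParts xs
sum-nonzeroParts (suc x ∷ xs) = cong (_+_ (suc x)) (sum-nonzeroParts xs)

∏-nonzeroParts : ∀ (h : ℕ → ℕ) → h 0 ≡ 1 → ∀ xs → ∏ h (nonzeroParts xs) ≡ ∏ h xs
∏-nonzeroParts h h0≡1 []           = refl
∏-nonzeroParts h h0≡1 (zero ∷ xs)  =
  trans (∏-nonzeroParts h h0≡1 xs) (trans (sym (ℕP.*-identityˡ _)) (cong (_* ∏ h xs) (sym h0≡1)))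
∏-nonzeroParts h h0≡1 (suc x ∷ xs) = cong (_*_ (h (suc x))) (∏-nonzeroParts h h0≡1 xs)

∏-↭ : ∀ (h : ℕ → ℕ) {xs ys} → xs ↭ ys → ∏ h xs ≡ ∏ h ys
∏-↭ h xs↭ys = product-↭ (map⁺ h xs↭ys)

≥-decTotalOrder : DecTotalOrder _ _ _
≥-decTotalOrder = Flip.decTotalOrder ℕP.≤-decTotalOrder

open Sort ≥-decTotalOrder using (sort; sort-↭; sort-↗)

nonincreasing-↭⇒≡ : ∀ {xs ys : List ℕ} → Linked _≥_ xs → Linked _≥_ ys → xs ↭ ys → xs ≡ ys
nonincreasing-↭⇒≡ xs↘ ys↘ xs↭ys = Pointwise.Pointwise-≡⇒≡ (Pointwise.map sym
  (SortedP.↗↭↗⇒≋ (DecTotalOrder.totalOrder ≥-decTotalOrder) xs↘ ys↘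
    (↭⇒↭ₛ′ (DecTotalOrder.isEquivalence ≥-decTotalOrder) xs↭ys)))

shape : ∀ {m} → Vec ℕ m → List ℕ
shape α = sort (nonzeroParts (toList α))

shape-isPartition : ∀ {m} (α : Vec ℕ m) → IsPartition (degree α) (shape α)
shape-isPartition α = record
  { nonincreasing = sort-↗ (nonzeroParts (toList α))
  ; positive      = All-resp-↭ (↭-sym (sort-↭ _)) (all-filter (1 ≤?_) (toList α))
  ; total         = trans (sum-↭ (sort-↭ _)) (sum-nonzeroParts (toList α))
  }

∏-shape : ∀ (h : ℕ → ℕ) → h 0 ≡ 1 → ∀ {m} (α : Vec ℕ m) → ∏ h (shape α) ≡ ∏ h (toList α)
∏-shape h h0≡1 α = trans (∏-↭ h (sort-↭ _)) (∏-nonzeroParts h h0≡1 (toList α))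

partWeight≡/∏! : ∀ S ps → partWeight S ps ≡ ∏ (card S) ps /∏! ps
partWeight≡/∏! S []       = refl
partWeight≡/∏! S (p ∷ ps) = trans (cong (_*ℚ_ ((+ card S p / p !) {{p ℕP.!≢0}})) (partWeight≡/∏! S ps))
  (/-*-/ (card S p) (p !) (∏ (card S) ps) (∏ _! ps) {{p ℕP.!≢0}} {{∏!≢0 ps}})

module _ (S : Species) {n : ℕ} {Ps : List (List ℕ)} (Ps-partitions : PartitionsOf n Ps) {m : ℕ} (α : Vec ℕ m) where

  private
    ∈Ps⇒isPartition : ∀ {ps} → ps ∈ Ps → IsPartition n ps
    ∈Ps⇒isPartition {ps} = Equivalence.to (proj₂ Ps-partitions ps)

  rhsCoeff-degree≢ : degree α ≢ n → rhsCoeff S Ps α ≡ 0ℚ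
  rhsCoeff-degree≢ deg≢n =
    sumWhere-none (nonzeroParts (toList α) ↭?_) (partWeight S) Ps λ {ps} ps∈Ps nz↭ps → deg≢n (begin
      degree α                       ≡⟨ sum-nonzeroParts (toList α) ⟨
      sum (nonzeroParts (toList α))  ≡⟨ sum-↭ nz↭ps ⟩
      sum ps                         ≡⟨ IsPartition.total (∈Ps⇒isPartition ps∈Ps) ⟩
      n                              ∎)
    where open ≡-Reasoning

  rhsCoeff-degree≡ : degree α ≡ n → rhsCoeff S Ps α ≡ ∏ (card S) (toList α) /∏! toList α
  rhsCoeff-degree≡ deg≡n = begin
    rhsCoeff S Ps α                     ≡⟨ sumWhere-unique (nonzeroParts (toList α) ↭?_) (partWeight S)
                                             (proj₁ Ps-partitions) shape∈Ps (↭-sym (sort-↭ _)) onlyShape ⟩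
    partWeight S (shape α)              ≡⟨ partWeight≡/∏! S (shape α) ⟩
    ∏ (card S) (shape α) /∏! shape α    ≡⟨ ℚP./-cong {{∏!≢0 (shape α)}} {{∏!≢0 (toList α)}}
                                             (cong +_ (∏-shape (card S) (Species.card-empty S) α)) (∏-shape _! refl α) ⟩
    ∏ (card S) (toList α) /∏! toList α  ∎
    where
    open ≡-Reasoning
    shape∈Ps : shape α ∈ Ps
    shape∈Ps = Equivalence.from (proj₂ Ps-partitions (shape α)) (subst (λ k → IsPartition k (shape α)) deg≡n (shape-isPartition α))
    onlyShape : ∀ {ps} → ps ∈ Ps → nonzeroParts (toList α) ↭ ps → ps ≡ shape α
    onlyShape ps∈Ps nz↭ps = nonincreasing-↭⇒≡ (IsPartition.nonincreasing (∈Ps⇒isPartition ps∈Ps)) (sort-↗ _)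
      (↭-trans (↭-sym nz↭ps) (↭-sym (sort-↭ _)))

proposition1 : (S : Species) (n : ℕ) (Ps : List (List ℕ)) → PartitionsOf n Ps →
               (m : ℕ) (α : Vec ℕ m) → qCoeff S n α ≡ rhsCoeff S Ps α
proposition1 S n Ps Ps-partitions m α with degree α ℕP.≟ n
... | yes deg≡n = trans (qCoeff-degree≡ S α deg≡n) (sym (rhsCoeff-degree≡ S Ps-partitions α deg≡n))
... | no  deg≢n = trans (qCoeff-degree≢ S α deg≢n) (sym (rhsCoeff-degree≢ S Ps-partitions α deg≢n))
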